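{- Let $h\geq 3$ and $k\geq 3h+1$ be positive integers, and let $A=[0,k]\setminus\{x\}$ with $x\in[1,k-1]$. (i) If $x\in[1,h-1]$, then $|h^{\wedge}A| = hk-h^2+x+1$. (ii) If $x\in[k-h+1,k-1]$, then $|h^{\wedge}A| = (h+1)k-h^2-x+1$. (iii) If $x\in\{h,k-h\}$, then $|h^{\wedge}A| = hk-h^2+h$. (iv) If $x\in[h+1,k-h-1]$, then $|h^{\wedge}A| = hk-h^2+h+1$.
   Context: For a finite set $A$ of integers and a positive integer $h\le |A|$, the restricted $h$-fold sumset $h^{\wedge}A$ is the set of all sums of $h$ distinct elements of $A$. For integers $\alpha\le\beta$, $[\alpha,\beta]=\{x\in\mathbb{Z}:\alpha\le x\le\beta\}$. -}

module Defs where

open import Data.Nat using (ℕ; zero; suc; _≟_)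
open import Data.List using (List; []; _∷_; _++_; map; length; filter; deduplicate; upTo)
open import Relation.Nullary using (¬?)
open import Data.Nat.ListAction using (sum)

combinations : ℕ → List ℕ → List (List ℕ)
combinations zero    _        = [] ∷ []
combinations (suc h) []       = []
combinations (suc h) (y ∷ ys) = map (y ∷_) (combinations h ys) ++ combinations (suc h) ys

intervalMinus : ℕ → ℕ → List ℕ
intervalMinus k x = filter (λ y → ¬? (y ≟ x)) (upTo (suc k))

-- Restricted h-fold sumset of a duplicate-free list A: all sums of h distinct
-- elements of A (as a list, possibly with repetitions).
restrictedSumsetList : ℕ → List ℕ → List ℕ
restrictedSumsetList h A = map sum (combinations h A)

restrictedSumsetCard : ℕ → List ℕ → ℕ
restrictedSumsetCard h A = length (deduplicate _≟_ (restrictedSumsetList h A))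

-- Write k = x + m, so A = [0, k] \ {x} = [0, x) ∪ (x, k]. The h-subsets of A with i elements below x
-- and j = h - i above it realise all sums in an interval (a block). Moving one element across x,
-- consecutive blocks overlap or touch as long as one side has an element to spare, so the blocks
-- chain into one interval; only when x = h or x = k - h does an extreme block stay isolated, since
-- the least sum plus one (greatest sum minus one) of h elements of [0, k] is attained only by a set
-- containing x. All sums lie between the least and greatest sums of h distinct elements of [0, k],
-- or, when x < h (x > k - h), of h + 1 such elements containing x, minus x.
module Submission where

open import Defs
open import Data.Nat using (ℕ; _≤_; _+_; _*_; _∸_)
open import Data.Integer using (ℤ; +_) renaming (_+_ to _+ℤ_; _*_ to _*ℤ_; _-_ to _-ℤ_)
open import Data.Product using (_×_)
open import Data.Sum using (_⊎_)
open import Relation.Binary.PropositionalEquality using (_≡_)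

open import Data.Empty using (⊥-elim)
import Data.Integer.Properties as ℤ
import Data.Integer.Tactic.RingSolver as ℤ-Solver
open import Data.List using (List; []; _∷_; _++_; map; length; filter; deduplicate; iterate; applyUpTo; upTo)
open import Data.List.Membership.Propositional using (_∈_; _∉_)
open import Data.List.Membership.Propositional.Properties
  using (∈-++⁺ˡ; ∈-++⁺ʳ; ∈-++⁻; ∈-map⁺; ∈-map⁻; deduplicate-∈⇔)
open import Data.List.Membership.Propositional.Properties.WithK using (unique∧set⇒bag)
open import Data.List.Properties using (filter-++; filter-all; filter-reject; length-iterate; length-++)
open import Data.List.Relation.Binary.BagAndSetEquality using (∼bag⇒↭)
open import Data.List.Relation.Binary.Permutation.Propositional.Properties using (↭-length)
open import Data.List.Relation.Binary.Sublist.Propositional using (_⊆_; []; _∷_; _∷ʳ_; ⊆-refl; ⊆-trans)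
import Data.List.Relation.Binary.Sublist.Propositional as Sublist
open import Data.List.Relation.Binary.Sublist.Propositional.Properties using (++⁺; []⊆-universal; length-mono-≤)
open import Data.List.Relation.Unary.Any using (here; there)
import Data.List.Relation.Unary.All as All
import Data.List.Relation.Unary.AllPairs as AllPairs
open import Data.List.Relation.Unary.Unique.Propositional using (Unique)
open import Data.List.Relation.Unary.Unique.Propositional.Properties using () renaming (++⁺ to Unique-++⁺)
open import Data.List.Relation.Unary.Unique.DecPropositional.Properties using (deduplicate-!)
open import Data.Nat using (zero; suc; _<_; z≤n; s≤s; z<s; _≟_; _≤?_; _<?_)
open import Data.Nat.ListAction using (sum)
open import Data.Nat.ListAction.Properties using (sum-++)
open import Data.Nat.Properties
open import Algebra.Properties.CommutativeSemigroup +-commutativeSemigroup using (x∙yz≈y∙xz)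
open import Data.Nat.Tactic.RingSolver using (solve-∀)
open import Data.Product using (_,_; proj₁; proj₂; ∃; ∃₂)
import Data.Sum as Sum
open import Data.Sum using (inj₁; inj₂; [_,_])
open import Function using (_∘_; _⇔_; mk⇔)
import Function.Properties.Equivalence as ⇔
open import Relation.Binary.PropositionalEquality using (_≢_; refl; sym; trans; cong; cong₂; subst; subst₂; module ≡-Reasoning)
open import Relation.Nullary using (Dec; ¬?; yes; no)

interval : ℕ → ℕ → List ℕ
interval = iterate suc

punctured : ℕ → ℕ → ℕ → List ℕ
punctured a n p = interval a n ++ interval (suc (a + n)) p

∈-interval⁻ : ∀ a n {s} → s ∈ interval a n → a ≤ s × s < a + n
∈-interval⁻ a (suc n) (here refl) = ≤-refl , m<m+n a z<s
∈-interval⁻ a (suc n) {s} (there s∈) with ∈-interval⁻ (suc a) n s∈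
... | a<s , s<a+1+n = <⇒≤ a<s , subst (s <_) (sym (+-suc a n)) s<a+1+n

∈-interval⁺ : ∀ a n {s} → a ≤ s → s < a + n → s ∈ interval a n
∈-interval⁺ a zero    a≤s s<a+0 = ⊥-elim (<⇒≱ s<a+0 (subst (_≤ _) (sym (+-identityʳ a)) a≤s))
∈-interval⁺ a (suc n) {s} a≤s s<a+n with a ≟ s
... | yes refl = here refl
... | no  a≢s  = there (∈-interval⁺ (suc a) n (≤∧≢⇒< a≤s a≢s) (subst (s <_) (+-suc a n) s<a+n))

interval-unique : ∀ a n → Unique (interval a n)
interval-unique a zero    = AllPairs.[]
interval-unique a (suc n) = All.tabulate (<⇒≢ ∘ proj₁ ∘ ∈-interval⁻ (suc a) n) AllPairs.∷ interval-unique (suc a) n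

interval-++ : ∀ a n p → interval a (n + p) ≡ interval a n ++ interval (a + n) p
interval-++ a zero    p = cong (λ b → interval b p) (sym (+-identityʳ a))
interval-++ a (suc n) p =
  cong (a ∷_) (trans (interval-++ (suc a) n p) (cong (λ b → interval (suc a) n ++ interval b p) (sym (+-suc a n))))

applyUpTo≡interval : ∀ (f : ℕ → ℕ) a n → (∀ i → f i ≡ a + i) → applyUpTo f n ≡ interval a n
applyUpTo≡interval f a zero    f≗a+ = refl
applyUpTo≡interval f a (suc n) f≗a+ =
  cong₂ _∷_ (trans (f≗a+ 0) (+-identityʳ a))
            (applyUpTo≡interval (f ∘ suc) (suc a) n (λ i → trans (f≗a+ (suc i)) (+-suc a i)))

punctured-unique : ∀ a n p → Unique (punctured a n p)
punctured-unique a n p = Unique-++⁺ (interval-unique a n) (interval-unique (suc (a + n)) p)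
  λ (s∈left , s∈right) →
    <⇒≱ (proj₂ (∈-interval⁻ a n s∈left)) (<⇒≤ (proj₁ (∈-interval⁻ (suc (a + n)) p s∈right)))

length-punctured : ∀ a n p → length (punctured a n p) ≡ n + p
length-punctured a n p =
  trans (length-++ (interval a n)) (cong₂ _+_ (length-iterate suc a n) (length-iterate suc (suc (a + n)) p))

∉-punctured : ∀ a n p → a + n ∉ punctured a n p
∉-punctured a n p a+n∈ with ∈-++⁻ (interval a n) a+n∈
... | inj₁ a+n∈left  = 1+n≰n (proj₂ (∈-interval⁻ a n a+n∈left))
... | inj₂ a+n∈right = 1+n≰n (proj₁ (∈-interval⁻ (suc (a + n)) p a+n∈right))

intervalMinus≡punctured : ∀ x m → intervalMinus (x + m) x ≡ punctured 0 x m
intervalMinus≡punctured x m = begin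
  filter ≢x? (upTo (suc (x + m)))
    ≡⟨ cong (filter ≢x?) (applyUpTo≡interval (λ i → i) 0 _ (λ _ → refl)) ⟩
  filter ≢x? (interval 0 (suc (x + m)))
    ≡⟨ cong (filter ≢x? ∘ interval 0) (sym (+-suc x m)) ⟩
  filter ≢x? (interval 0 (x + suc m))
    ≡⟨ cong (filter ≢x?) (interval-++ 0 x (suc m)) ⟩
  filter ≢x? (interval 0 x ++ x ∷ interval (suc x) m)
    ≡⟨ filter-++ ≢x? (interval 0 x) _ ⟩
  filter ≢x? (interval 0 x) ++ filter ≢x? (x ∷ interval (suc x) m)
    ≡⟨ cong₂ _++_ (filter-all ≢x? (All.tabulate (<⇒≢ ∘ proj₂ ∘ ∈-interval⁻ 0 x)))
                  (trans (filter-reject ≢x? (λ x≢x → x≢x refl))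
                         (filter-all ≢x? (All.tabulate (>⇒≢ ∘ proj₁ ∘ ∈-interval⁻ (suc x) m)))) ⟩
  punctured 0 x m
    ∎
  where
  open ≡-Reasoning
  ≢x? : ∀ y → Dec (y ≢ x)
  ≢x? y = ¬? (y ≟ x)

-- Restricted sums as sums of sublists

∈-combinations⁻ : ∀ h L {c} → c ∈ combinations h L → c ⊆ L × length c ≡ h
∈-combinations⁻ zero    L       (here refl) = []⊆-universal L , refl
∈-combinations⁻ (suc h) (y ∷ L) c∈ with ∈-++⁻ (map (y ∷_) (combinations h L)) c∈
... | inj₂ c∈skip = let σ , len = ∈-combinations⁻ (suc h) L c∈skip in y ∷ʳ σ , len
... | inj₁ c∈take with ∈-map⁻ (y ∷_) c∈take
...   | c , c∈ , refl = let σ , len = ∈-combinations⁻ h L c∈ in refl ∷ σ , cong suc len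

∈-combinations⁺ : ∀ {L c} → c ⊆ L → c ∈ combinations (length c) L
∈-combinations⁺ []         = here refl
∈-combinations⁺ {y ∷ L} {[]}    (y ∷ʳ σ) = here refl
∈-combinations⁺ {y ∷ L} {z ∷ c} (y ∷ʳ σ) = ∈-++⁺ʳ (map (y ∷_) (combinations (length c) L)) (∈-combinations⁺ σ)
∈-combinations⁺ (refl ∷ σ) = ∈-++⁺ˡ (∈-map⁺ _ (∈-combinations⁺ σ))

∈-restrictedSumsetList⁻ : ∀ h A {s} → s ∈ restrictedSumsetList h A → ∃ λ c → c ⊆ A × length c ≡ h × sum c ≡ s
∈-restrictedSumsetList⁻ h A s∈ with ∈-map⁻ sum s∈
... | c , c∈ , refl = let σ , len = ∈-combinations⁻ h A c∈ in c , σ , len , refl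

∈-restrictedSumsetList⁺ : ∀ {A c} → c ⊆ A → sum c ∈ restrictedSumsetList (length c) A
∈-restrictedSumsetList⁺ σ = ∈-map⁺ sum (∈-combinations⁺ σ)

⊆-insert : ∀ L₁ {L₂ y c} → c ⊆ L₁ ++ L₂ →
           ∃ λ c′ → c′ ⊆ L₁ ++ y ∷ L₂ × length c′ ≡ suc (length c) × sum c′ ≡ y + sum c
⊆-insert []       σ        = _ , refl ∷ σ , refl , refl
⊆-insert (z ∷ L₁) (z ∷ʳ σ) = let c′ , σ′ , len , eq = ⊆-insert L₁ σ in c′ , z ∷ʳ σ′ , len , eq
⊆-insert (z ∷ L₁) {y = y} (_∷_ {xs = c} refl σ) =
  let c′ , σ′ , len , eq = ⊆-insert L₁ σ
  in z ∷ c′ , refl ∷ σ′ , cong suc len , trans (cong (_+_ z) eq) (x∙yz≈y∙xz z y (sum c))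

-- Sums of sublists of an interval

-- triangular n = 0 + 1 + ⋯ + (n - 1), the least sum of n distinct naturals.
triangular : ℕ → ℕ
triangular zero    = 0
triangular (suc n) = n + triangular n

triangular-+ : ∀ a b → triangular (a + b) ≡ triangular a + triangular b + a * b
triangular-+ zero    b = sym (+-identityʳ (triangular b))
triangular-+ (suc a) b = trans (cong (_+_ (a + b)) (triangular-+ a b)) (regroup a b (triangular a) (triangular b))
  where
  regroup : ∀ a b s t → a + b + (s + t + a * b) ≡ a + s + t + suc a * b
  regroup = solve-∀

sum-⊆-interval-≥ : ∀ a n {c} → c ⊆ interval a n → length c * a + triangular (length c) ≤ sum c
sum-⊆-interval-≥ a zero    []           = z≤n
sum-⊆-interval-≥ a (suc n) {c} (_ ∷ʳ σ) =
  ≤-trans (+-monoˡ-≤ _ (*-monoʳ-≤ (length c) (n≤1+n a))) (sum-⊆-interval-≥ (suc a) n σ)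
sum-⊆-interval-≥ a (suc n) (_∷_ {xs = c} refl σ) = begin
  suc l * a + triangular (suc l)  ≡⟨ shift l a (triangular l) ⟩
  a + (l * suc a + triangular l)  ≤⟨ +-monoʳ-≤ a (sum-⊆-interval-≥ (suc a) n σ) ⟩
  a + sum c                       ∎
  where
  open ≤-Reasoning
  l : ℕ
  l = length c
  shift : ∀ l a t → suc l * a + (l + t) ≡ a + (l * suc a + t)
  shift = solve-∀

sum-⊆-interval-≤ : ∀ a j p {c} → c ⊆ interval a (j + p) → length c ≡ j → sum c ≤ j * (a + p) + triangular j
sum-⊆-interval-≤ a zero    p {[]} σ refl = z≤n
sum-⊆-interval-≤ a (suc j) p (_∷_ {xs = c} refl σ) refl = begin
  a + sum c                                 ≤⟨ +-monoʳ-≤ a (sum-⊆-interval-≤ (suc a) j p σ refl) ⟩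
  a + (j * (suc a + p) + triangular j)      ≤⟨ +-monoˡ-≤ (j * (suc a + p) + triangular j) (m≤m+n a p) ⟩
  a + p + (j * (suc a + p) + triangular j)  ≡⟨ shift a p j (triangular j) ⟩
  suc j * (a + p) + triangular (suc j)      ∎
  where
  open ≤-Reasoning
  shift : ∀ a p j t → a + p + (j * (suc a + p) + t) ≡ suc j * (a + p) + (j + t)
  shift = solve-∀
sum-⊆-interval-≤ a (suc j) zero (_ ∷ʳ σ) len =
  ⊥-elim (1+n≰n (subst₂ _≤_ len (trans (length-iterate suc (suc a) (j + 0)) (+-identityʳ j)) (length-mono-≤ σ)))
sum-⊆-interval-≤ a (suc j) (suc p) {c} (_ ∷ʳ σ) len =
  subst (λ b → sum c ≤ suc j * b + triangular (suc j)) (sym (+-suc a p))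
    (sum-⊆-interval-≤ (suc a) (suc j) p (subst (λ n → c ⊆ interval (suc a) n) (+-suc j p) σ) len)

-- Either the least element a is kept, or it is skipped and every chosen element moves up by one.
⊆-interval-with-sum : ∀ a j p t → t ≤ j * p →
                      ∃ λ c → c ⊆ interval a (j + p) × length c ≡ j × sum c ≡ j * a + triangular j + t
⊆-interval-with-sum a zero p t t≤0 rewrite n≤0⇒n≡0 t≤0 = [] , []⊆-universal _ , refl , refl
⊆-interval-with-sum a (suc j) p t t≤ with t ≤? j * p
... | yes t≤′ =
  let c , σ , len , eq = ⊆-interval-with-sum (suc a) j p t t≤′
  in a ∷ c , refl ∷ σ , cong suc len , trans (cong (_+_ a) eq) (keep-a a j (triangular j) t)
  where
  keep-a : ∀ a j s t → a + (j * suc a + s + t) ≡ suc j * a + (j + s) + t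
  keep-a = solve-∀
... | no t≰ with p
...   | zero  = ⊥-elim (t≰ (subst (t ≤_) (trans (*-zeroʳ (suc j)) (sym (*-zeroʳ j))) t≤))
...   | suc p with m≤n⇒∃[o]m+o≡n (≤-trans (s≤s (m≤m+n j (j * p))) (subst (_< t) (*-suc j p) (≰⇒> t≰)))
...     | t′ , refl =
  let c , σ , len , eq = ⊆-interval-with-sum (suc a) (suc j) p t′
                           (+-cancelˡ-≤ (suc j) _ _ (subst (suc j + t′ ≤_) (*-suc (suc j) p) t≤))
  in c , a ∷ʳ subst (λ n → c ⊆ interval (suc a) n) (sym (+-suc j p)) σ , len ,
     trans eq (skip-a a j (triangular (suc j)) t′)
  where
  skip-a : ∀ a j s t → suc j * suc a + s + t ≡ suc j * a + s + (suc j + t)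
  skip-a = solve-∀

least-sum+1⇒∈ : ∀ a n {c} → c ⊆ interval a n → sum c ≡ length c * a + triangular (length c) + 1 → a + length c ∈ c
least-sum+1⇒∈ a zero    [] ()
least-sum+1⇒∈ a (suc n) (_∷_ {xs = c} refl σ) eq =
  there (subst (_∈ c) (sym (+-suc a l))
    (least-sum+1⇒∈ (suc a) n σ (+-cancelˡ-≡ a _ _ (trans eq (keep-a a l (triangular l))))))
  where
  l : ℕ
  l = length c
  keep-a : ∀ a l t → suc l * a + (l + t) + 1 ≡ a + (l * suc a + t + 1)
  keep-a = solve-∀
least-sum+1⇒∈ a (suc n) {c} (_ ∷ʳ σ) eq = singleton c (+-cancelˡ-≤ (length c * a + triangular (length c)) _ _ bound) eq
  where
  shift : ∀ l a t → l * a + t + l ≡ l * suc a + t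
  shift = solve-∀
  bound : length c * a + triangular (length c) + length c ≤ length c * a + triangular (length c) + 1
  bound = subst₂ _≤_ (sym (shift (length c) a _)) eq (sum-⊆-interval-≥ (suc a) n σ)
  singleton : ∀ c → length c ≤ 1 → sum c ≡ length c * a + triangular (length c) + 1 → a + length c ∈ c
  singleton (y ∷ [])    _        eq = here (sym (trans (sym (+-identityʳ y)) (trans eq (one a))))
    where
    one : ∀ a → 1 * a + 0 + 1 ≡ a + 1
    one = solve-∀
  singleton (_ ∷ _ ∷ _) (s≤s ()) _

greatest-sum∸1⇒∈ : ∀ a j p {c} → c ⊆ interval a (j + suc p) → length c ≡ j →
                   suc (sum c) ≡ j * (a + suc p) + triangular j → a + p ∈ c
greatest-sum∸1⇒∈ a zero    p {[]} σ refl ()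
greatest-sum∸1⇒∈ a (suc j) zero    (refl ∷ σ) len eq = here (+-identityʳ a)
greatest-sum∸1⇒∈ a (suc j) (suc p) (_∷_ {xs = c} refl σ) len eq = ⊥-elim (<⇒≱ B<a+Σc a+Σc≤B)
  where
  B : ℕ
  B = a + (j * (suc a + suc (suc p)) + triangular j)
  a+Σc≤B : a + sum c ≤ B
  a+Σc≤B = +-monoʳ-≤ a (sum-⊆-interval-≤ (suc a) j (suc (suc p)) σ (suc-injective len))
  top : ∀ a j p t → suc j * (a + suc (suc p)) + (j + t) ≡ suc (suc p) + (a + (j * (suc a + suc (suc p)) + t))
  top = solve-∀
  B<a+Σc : B < a + sum c
  B<a+Σc = subst (B <_) (suc-injective (sym (trans eq (top a j p (triangular j))))) (s≤s (m≤n+m B p))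
greatest-sum∸1⇒∈ a (suc j) zero {c} (_ ∷ʳ σ) len eq =
  ⊥-elim (<⇒≱ (≤-reflexive (trans eq shift))
                (subst (λ l → l * suc a + triangular l ≤ sum c) len (sum-⊆-interval-≥ (suc a) (j + 1) σ)))
  where
  shift : suc j * (a + 1) + triangular (suc j) ≡ suc j * suc a + triangular (suc j)
  shift = cong (λ b → suc j * b + triangular (suc j)) (+-comm a 1)
greatest-sum∸1⇒∈ a (suc j) (suc p) {c} (_ ∷ʳ σ) len eq =
  subst (_∈ c) (sym (+-suc a p))
    (greatest-sum∸1⇒∈ (suc a) (suc j) p (subst (λ n → c ⊆ interval (suc a) n) (+-suc j (suc p)) σ) len
      (trans eq (cong (λ b → suc j * b + triangular (suc j)) (+-suc a (suc p)))))

length-deduplicate : ∀ {l C : List ℕ} → Unique C → (∀ {s} → s ∈ l ⇔ s ∈ C) →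
                     length (deduplicate _≟_ l) ≡ length C
length-deduplicate {l} C! l⇔C =
  ↭-length (∼bag⇒↭ (unique∧set⇒bag (deduplicate-! _≟_ l) C! (⇔.trans (⇔.sym (deduplicate-∈⇔ _≟_)) l⇔C)))

Covers : (ℕ → Set) → ℕ → ℕ → Set
Covers P L U = ∀ {s} → L ≤ s → s ≤ U → P s

covers-join : ∀ {P L U L′ U′} → Covers P L U → Covers P L′ U′ → L′ ≤ suc U → Covers P L U′
covers-join {U = U} cov cov′ L′≤1+U {s} L≤s s≤U′ with s ≤? U
... | yes s≤U = cov L≤s s≤U
... | no  s≰U = cov′ (≤-trans L′≤1+U (≰⇒> s≰U)) s≤U′

covers⇒⇔-interval : ∀ {P : ℕ → Set} {L W} → Covers P L (L + W) → (∀ {s} → P s → L ≤ s × s ≤ L + W) →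
                    ∀ {s} → P s ⇔ s ∈ interval L (suc W)
covers⇒⇔-interval {L = L} {W} cov bounds {s} = mk⇔
  (λ Ps → let L≤s , s≤L+W = bounds Ps in ∈-interval⁺ L (suc W) L≤s (subst (s <_) (sym (+-suc L W)) (s≤s s≤L+W)))
  (λ s∈ → let L≤s , s<L+1+W = ∈-interval⁻ L (suc W) s∈ in cov L≤s (≤-pred (subst (s <_) (+-suc L W) s<L+1+W)))

covers⇒⇔-punctured : ∀ {P : ℕ → Set} {a n p} → Covers P a (a + n) → Covers P (suc (a + suc n)) (a + suc n + p) →
                     (∀ {s} → P s → a ≤ s × s ≤ a + suc n + p × s ≢ a + suc n) →
                     ∀ {s} → P s ⇔ s ∈ punctured a (suc n) p
covers⇒⇔-punctured {P = P} {a} {n} {p} covˡ covʳ bounds {s} = mk⇔ to from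
  where
  to : P s → s ∈ punctured a (suc n) p
  to Ps with bounds Ps | s <? a + suc n
  ... | a≤s , _ , _ | yes s<hole = ∈-++⁺ˡ (∈-interval⁺ a (suc n) a≤s s<hole)
  ... | _ , s≤top , s≢hole | no s≮hole = ∈-++⁺ʳ (interval a (suc n))
    (∈-interval⁺ (suc (a + suc n)) p (≤∧≢⇒< (≮⇒≥ s≮hole) (s≢hole ∘ sym)) (s≤s s≤top))
  from : s ∈ punctured a (suc n) p → P s
  from s∈ with ∈-++⁻ (interval a (suc n)) s∈
  ... | inj₁ s∈left  = let a≤s , s<hole = ∈-interval⁻ a (suc n) s∈left
                       in covˡ a≤s (≤-pred (subst (s <_) (+-suc a n) s<hole))
  ... | inj₂ s∈right = let hole<s , s<end = ∈-interval⁻ (suc (a + suc n)) p s∈right in covʳ hole<s (≤-pred s<end)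

≤-+-split : ∀ {t} p q → t ≤ p + q → ∃₂ λ t₁ t₂ → t₁ + t₂ ≡ t × t₁ ≤ p × t₂ ≤ q
≤-+-split {t} p q t≤p+q with t ≤? p
... | yes t≤p = t , 0 , +-identityʳ t , t≤p , z≤n
... | no  t≰p =
  p , t ∸ p , m+[n∸m]≡n (<⇒≤ (≰⇒> t≰p)) , ≤-refl , subst (t ∸ p ≤_) (m+n∸m≡n p q) (∸-monoˡ-≤ p t≤p+q)

-- Blocks

-- The block (i, j) consists of the subsets with i elements below x and j above x; least i j is
-- its least sum, and with d₁ = x - i and d₂ = m - j its sums are exactly [least i j, greatest i j d₁ d₂].
module Blocks (x m h : ℕ) where

  IsSum : ℕ → Set
  IsSum s = s ∈ restrictedSumsetList h (punctured 0 x m)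

  least : ℕ → ℕ → ℕ
  least i j = triangular i + triangular j + j * suc x

  greatest : ℕ → ℕ → ℕ → ℕ → ℕ
  greatest i j d₁ d₂ = least i j + (i * d₁ + j * d₂)

  block-covers : ∀ i j d₁ d₂ → x ≡ i + d₁ → m ≡ j + d₂ → i + j ≡ h →
                 Covers IsSum (least i j) (greatest i j d₁ d₂)
  block-covers i j d₁ d₂ refl refl refl {s} L≤s s≤U with m≤n⇒∃[o]m+o≡n L≤s
  ... | t , refl =
    let t₁ , t₂ , t₁+t₂≡t , t₁≤ , t₂≤ = ≤-+-split (i * d₁) (j * d₂) (+-cancelˡ-≤ (least i j) _ _ s≤U)
        c₁ , σ₁ , len₁ , sum₁ = ⊆-interval-with-sum 0 i d₁ t₁ t₁≤
        c₂ , σ₂ , len₂ , sum₂ = ⊆-interval-with-sum (suc (i + d₁)) j d₂ t₂ t₂≤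
    in subst₂ (λ s h → s ∈ restrictedSumsetList h (punctured 0 (i + d₁) (j + d₂)))
         (begin
           sum (c₁ ++ c₂)
             ≡⟨ sum-++ c₁ c₂ ⟩
           sum c₁ + sum c₂
             ≡⟨ cong₂ _+_ sum₁ sum₂ ⟩
           i * 0 + triangular i + t₁ + (j * suc (i + d₁) + triangular j + t₂)
             ≡⟨ regroup i (triangular i) t₁ j (i + d₁) (triangular j) t₂ ⟩
           least i j + (t₁ + t₂)
             ≡⟨ cong (_+_ (least i j)) t₁+t₂≡t ⟩
           least i j + t
             ∎)
         (trans (length-++ c₁) (cong₂ _+_ len₁ len₂))
         (∈-restrictedSumsetList⁺ (++⁺ σ₁ σ₂))
    where
    open ≡-Reasoning
    regroup : ∀ i ti t₁ j x tj t₂ → i * 0 + ti + t₁ + (j * suc x + tj + t₂) ≡ ti + tj + j * suc x + (t₁ + t₂)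
    regroup = solve-∀

  block-step : ∀ i j d₁ d₂ {L} → x ≡ suc i + d₁ → m ≡ suc j + d₂ → suc i + j ≡ h →
               1 ≤ i * d₁ + j * d₂ →
               Covers IsSum L (greatest (suc i) j d₁ (suc d₂)) → Covers IsSum L (greatest i (suc j) (suc d₁) d₂)
  block-step i j d₁ d₂ refl em eh slack cov =
    covers-join cov (block-covers i (suc j) (suc d₁) d₂ (sym (+-suc i d₁)) em (trans (+-suc i j) eh)) blocks-meet
    where
    open ≤-Reasoning
    gap : ∀ i j d₁ d₂ ti tj → ti + (j + tj) + suc j * suc (suc i + d₁) + (i * d₁ + j * d₂)
                          ≡ suc (suc (i + ti + tj + j * suc (suc i + d₁) + (suc i * d₁ + j * suc d₂)))
    gap = solve-∀
    blocks-meet : least i (suc j) ≤ suc (greatest (suc i) j d₁ (suc d₂))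
    blocks-meet = ≤-pred (begin
      suc (least i (suc j))                       ≡⟨ +-comm 1 _ ⟩
      least i (suc j) + 1                         ≤⟨ +-monoʳ-≤ (least i (suc j)) slack ⟩
      least i (suc j) + (i * d₁ + j * d₂)         ≡⟨ gap i j d₁ d₂ (triangular i) (triangular j) ⟩
      suc (suc (greatest (suc i) j d₁ (suc d₂)))  ∎)

  block-chain : ∀ n i j d₁ d₂ → x ≡ i + n + d₁ → m ≡ j + n + d₂ → i + n + j ≡ h →
                (1 ≤ i × 1 ≤ d₁) ⊎ (1 ≤ j × 1 ≤ d₂) →
                Covers IsSum (least (i + n) j) (greatest i (j + n) (n + d₁) d₂)
  block-chain zero i j d₁ d₂ ex em eh slack =
    subst₂ (λ a b → Covers IsSum (least a j) (greatest i b d₁ d₂)) (sym (+-identityʳ i)) (sym (+-identityʳ j))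
      (block-covers i j d₁ d₂ (trans ex (cong (_+ d₁) (+-identityʳ i))) (trans em (cong (_+ d₂) (+-identityʳ j)))
                    (trans (cong (_+ j) (sym (+-identityʳ i))) eh))
  block-chain (suc n) i j d₁ d₂ ex em eh slack =
    subst₂ (λ a b → Covers IsSum (least a j) (greatest i b (suc n + d₁) d₂)) (sym (+-suc i n)) (sym (+-suc j n))
      (block-step i (j + n) (n + d₁) d₂
        (trans ex (trans (+-assoc i (suc n) d₁) (+-suc i (n + d₁))))
        (trans em (cong (_+ d₂) (+-suc j n)))
        (trans (regroup i j n) eh)
        last-slack
        (block-chain n (suc i) j d₁ (suc d₂)
          (trans ex (cong (_+ d₁) (+-suc i n)))
          (trans em (trans (cong (_+ d₂) (+-suc j n)) (sym (+-suc (j + n) d₂))))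
          (trans (cong (_+ j) (sym (+-suc i n))) eh)
          (Sum.map (λ (_ , 1≤d₁) → s≤s z≤n , 1≤d₁) (λ (1≤j , _) → 1≤j , s≤s z≤n) slack)))
    where
    regroup : ∀ i j n → suc i + (j + n) ≡ i + suc n + j
    regroup = solve-∀
    last-slack : 1 ≤ i * (n + d₁) + (j + n) * d₂
    last-slack = [ (λ (1≤i , 1≤d₁) → ≤-trans (*-mono-≤ 1≤i (≤-trans 1≤d₁ (m≤n+m d₁ n))) (m≤m+n _ _))
                 , (λ (1≤j , 1≤d₂) → ≤-trans (*-mono-≤ (≤-trans 1≤j (m≤m+n j n)) 1≤d₂) (m≤n+m _ _)) ] slack

  punctured-filled : interval 0 x ++ x ∷ interval (suc x) m ≡ interval 0 (suc (x + m))
  punctured-filled = trans (sym (interval-++ 0 x (suc m))) (cong (interval 0) (+-suc x m))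

  punctured⊆interval : punctured 0 x m ⊆ interval 0 (suc (x + m))
  punctured⊆interval = subst (punctured 0 x m ⊆_) punctured-filled (++⁺ ⊆-refl (x ∷ʳ ⊆-refl))

  ⊆-insert-x : ∀ {c} → c ⊆ punctured 0 x m →
               ∃ λ c′ → c′ ⊆ interval 0 (suc (x + m)) × length c′ ≡ suc (length c) × sum c′ ≡ x + sum c
  ⊆-insert-x σ = let c′ , σ′ , len , eq = ⊆-insert (interval 0 x) σ in c′ , subst (c′ ⊆_) punctured-filled σ′ , len , eq

  sum-≥ : ∀ {s} → IsSum s → triangular h ≤ s
  sum-≥ s∈ with ∈-restrictedSumsetList⁻ h (punctured 0 x m) s∈
  ... | c , σ , refl , refl = subst (λ a → a + triangular (length c) ≤ sum c) (*-zeroʳ (length c))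
                                (sum-⊆-interval-≥ 0 _ (⊆-trans σ punctured⊆interval))

  sum-≤ : ∀ p → suc (x + m) ≡ h + p → ∀ {s} → IsSum s → s ≤ h * p + triangular h
  sum-≤ p eq s∈ with ∈-restrictedSumsetList⁻ h (punctured 0 x m) s∈
  ... | c , σ , len , refl =
    sum-⊆-interval-≤ 0 h p (subst (λ n → c ⊆ interval 0 n) eq (⊆-trans σ punctured⊆interval)) len

  x+sum-≥ : ∀ {s} → IsSum s → triangular (suc h) ≤ x + s
  x+sum-≥ s∈ with ∈-restrictedSumsetList⁻ h (punctured 0 x m) s∈
  ... | c , σ , refl , refl with ⊆-insert-x σ
  ...   | c′ , σ′ , len , eq =
    subst₂ _≤_ (trans (cong (λ a → a + triangular (length c′)) (*-zeroʳ (length c′))) (cong triangular len)) eq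
      (sum-⊆-interval-≥ 0 _ σ′)

  x+sum-≤ : ∀ p → suc (x + m) ≡ suc h + p → ∀ {s} → IsSum s → x + s ≤ suc h * p + triangular (suc h)
  x+sum-≤ p eq s∈ with ∈-restrictedSumsetList⁻ h (punctured 0 x m) s∈
  ... | c , σ , refl , refl with ⊆-insert-x σ
  ...   | c′ , σ′ , len , eq′ = subst (_≤ suc h * p + triangular (suc h)) eq′
                                  (sum-⊆-interval-≤ 0 (suc h) p (subst (λ n → c′ ⊆ interval 0 n) eq σ′) len)

  sum≢least+1 : x ≡ h → ∀ {s} → IsSum s → s ≢ triangular h + 1
  sum≢least+1 refl s∈ eq with ∈-restrictedSumsetList⁻ h (punctured 0 x m) s∈
  ... | c , σ , refl , refl = ∉-punctured 0 x m (Sublist.lookup σ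
          (least-sum+1⇒∈ 0 _ (⊆-trans σ punctured⊆interval)
                             (trans eq (cong (λ a → a + triangular x + 1) (sym (*-zeroʳ x))))))

  suc-sum≢greatest : m ≡ h → ∀ {s} → IsSum s → suc s ≢ h * suc x + triangular h
  suc-sum≢greatest refl s∈ eq with ∈-restrictedSumsetList⁻ h (punctured 0 x m) s∈
  ... | c , σ , refl , refl = ∉-punctured 0 x m (Sublist.lookup σ
          (greatest-sum∸1⇒∈ 0 m x (subst (λ n → c ⊆ interval 0 n) (trans (cong suc (+-comm x m)) (sym (+-suc m x)))
                                          (⊆-trans σ punctured⊆interval)) refl eq))

  card-interval : ∀ {L U W} → L + W ≡ U → Covers IsSum L U → (∀ {s} → IsSum s → L ≤ s × s ≤ U) →
                  restrictedSumsetCard h (punctured 0 x m) ≡ suc W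
  card-interval {L} {W = W} refl cov bounds =
    trans (length-deduplicate (interval-unique L (suc W)) (covers⇒⇔-interval cov bounds)) (length-iterate suc L (suc W))

  card-punctured : ∀ {a n p} → Covers IsSum a (a + n) → Covers IsSum (suc (a + suc n)) (a + suc n + p) →
                   (∀ {s} → IsSum s → a ≤ s × s ≤ a + suc n + p × s ≢ a + suc n) →
                   restrictedSumsetCard h (punctured 0 x m) ≡ suc n + p
  card-punctured {a} {n} {p} covˡ covʳ bounds =
    trans (length-deduplicate (punctured-unique a (suc n) p) (covers⇒⇔-punctured covˡ covʳ bounds))
          (length-punctured a (suc n) p)

<⇒≡+suc : ∀ {a b} → a < b → ∃ λ d → b ≡ a + suc d
<⇒≡+suc {a} a<b = let d , eq = m≤n⇒∃[o]m+o≡n a<b in d , trans (sym eq) (sym (+-suc a d))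

<⇒≡suc+ : ∀ {a b} → a < b → ∃ λ d → b ≡ suc d + a
<⇒≡suc+ {a} a<b = let d , eq = <⇒≡+suc a<b in d , trans eq (+-comm a (suc d))

card-hole-middle : ∀ {h x m} → 2 ≤ h → h < x → h < m →
                   restrictedSumsetCard h (punctured 0 x m) + h * h ≡ h * (x + m) + (h + 1)
card-hole-middle {suc g} (s≤s 1≤g) h<x h<m with <⇒≡+suc h<x | <⇒≡+suc h<m
... | e₁ , refl | e₂ , refl = trans (cong (λ c → c + h * h) (card-interval spread covered bounded)) (count g e₁ e₂)
  where
  h x m : ℕ
  h = suc g
  x = h + suc e₁
  m = h + suc e₂
  open Blocks x m h
  -- The blocks (h, 0), …, (1, g) chain using the room below x, the last step to (0, h) the room above x.
  lower : Covers IsSum (least h 0) (greatest 1 g (g + suc e₁) (suc (suc e₂)))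
  lower = block-chain g 1 0 (suc e₁) (suc (suc e₂)) refl (sym (+-suc g (suc e₂))) (cong suc (+-identityʳ g))
                      (inj₁ (≤-refl , s≤s z≤n))
  covered : Covers IsSum (least h 0) (greatest 0 h (suc (g + suc e₁)) (suc e₂))
  covered = block-step 0 g (g + suc e₁) (suc e₂) refl refl refl (≤-trans 1≤g (m≤m*n g (suc e₂))) lower
  W : ℕ
  W = h * suc x + h * suc e₂
  spread : least h 0 + W ≡ greatest 0 h (suc (g + suc e₁)) (suc e₂)
  spread = regroup (triangular h) (h * suc x) (h * suc e₂) (suc (g + suc e₁))
    where
    regroup : ∀ t a b c → t + 0 + 0 + (a + b) ≡ 0 + t + a + (0 * c + b)
    regroup = solve-∀
  bounded : ∀ {s} → IsSum s → least h 0 ≤ s × s ≤ greatest 0 h (suc (g + suc e₁)) (suc e₂)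
  bounded {s} s∈ = subst (_≤ s) (sym (trans (+-identityʳ _) (+-identityʳ _))) (sum-≥ s∈)
                 , subst (s ≤_) (bound≡greatest g e₁ e₂ (triangular h)) (sum-≤ (suc x + suc e₂) (k+1≡h+p g e₁ e₂) s∈)
    where
    k+1≡h+p : ∀ g e₁ e₂ → suc (suc g + suc e₁ + (suc g + suc e₂)) ≡ suc g + (suc (suc g + suc e₁) + suc e₂)
    k+1≡h+p = solve-∀
    bound≡greatest : ∀ g e₁ e₂ t → suc g * (suc (suc g + suc e₁) + suc e₂) + t
                      ≡ 0 + t + suc g * suc (suc g + suc e₁) + (0 * suc (g + suc e₁) + suc g * suc e₂)
    bound≡greatest = solve-∀
  count : ∀ g e₁ e₂ → suc (suc g * suc (suc g + suc e₁) + suc g * suc e₂) + suc g * suc g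
                    ≡ suc g * (suc g + suc e₁ + (suc g + suc e₂)) + (suc g + 1)
  count = solve-∀

card-hole<h : ∀ {h x m} → x < h → h < m →
              restrictedSumsetCard h (punctured 0 x m) + h * h ≡ h * (x + m) + (x + 1)
card-hole<h {x = x} x<h h<m with <⇒≡suc+ x<h
... | e , refl with <⇒≡+suc h<m
... | f , refl = trans (cong (λ c → c + h * h) (card-interval spread covered bounded)) (count e x f)
  where
  J h : ℕ
  J = suc e
  h = J + x
  open Blocks x (h + suc f) h
  covered : Covers IsSum (least x J) (greatest 0 h (x + 0) (suc f))
  covered = block-chain x 0 J 0 (suc f) (sym (+-identityʳ x)) refl (+-comm x J) (inj₂ (s≤s z≤n , s≤s z≤n))
  W : ℕ
  W = J * x + x * suc x + h * suc f
  spread : least x J + W ≡ greatest 0 h (x + 0) (suc f)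
  spread = trans (regroup e x f (triangular e) (triangular x))
                 (cong (λ t → 0 + t + h * suc x + (0 * (x + 0) + h * suc f)) (sym (triangular-+ J x)))
    where
    regroup : ∀ e x f te tx → tx + (e + te) + suc e * suc x + (suc e * x + x * suc x + (suc e + x) * suc f)
                            ≡ 0 + (e + te + tx + suc e * x) + (suc e + x) * suc x + (0 * (x + 0) + (suc e + x) * suc f)
    regroup = solve-∀
  x+least : x + least x J ≡ triangular (suc h)
  x+least = trans (regroup e x (triangular e) (triangular x)) (cong (_+_ h) (sym (triangular-+ J x)))
    where
    regroup : ∀ e x te tx → x + (tx + (e + te) + suc e * suc x) ≡ suc e + x + (e + te + tx + suc e * x)
    regroup = solve-∀
  bounded : ∀ {s} → IsSum s → least x J ≤ s × s ≤ greatest 0 h (x + 0) (suc f)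
  bounded {s} s∈ = +-cancelˡ-≤ x _ _ (subst (_≤ x + s) (sym x+least) (x+sum-≥ s∈))
                 , subst (s ≤_) (bound≡greatest e x f (triangular h)) (sum-≤ (suc x + suc f) (k+1≡h+p e x f) s∈)
    where
    k+1≡h+p : ∀ e x f → suc (x + (suc e + x + suc f)) ≡ suc e + x + (suc x + suc f)
    k+1≡h+p = solve-∀
    bound≡greatest : ∀ e x f t → (suc e + x) * (suc x + suc f) + t ≡ 0 + t + (suc e + x) * suc x + (0 * (x + 0) + (suc e + x) * suc f)
    bound≡greatest = solve-∀
  count : ∀ e x f → suc (suc e * x + x * suc x + (suc e + x) * suc f) + (suc e + x) * (suc e + x)
                  ≡ (suc e + x) * (x + (suc e + x + suc f)) + (x + 1)
  count = solve-∀

card-hole>k∸h : ∀ {h x m} → m < h → h < x →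
                restrictedSumsetCard h (punctured 0 x m) + h * h + x ≡ (h + 1) * (x + m) + 1
card-hole>k∸h {m = m} m<h h<x with <⇒≡suc+ m<h
... | e , refl with <⇒≡+suc h<x
... | f , refl = trans (cong (λ c → c + h * h + x) (card-interval spread covered bounded)) (count e m f)
  where
  I h x : ℕ
  I = suc e
  h = I + m
  x = h + suc f
  open Blocks x m h
  covered : Covers IsSum (least h 0) (greatest I m (m + suc f) 0)
  covered = block-chain m I 0 (suc f) 0 refl (sym (+-identityʳ m)) (+-identityʳ h) (inj₁ (s≤s z≤n , s≤s z≤n))
  W : ℕ
  W = m * suc x + I * suc f
  spread : least h 0 + W ≡ greatest I m (m + suc f) 0
  spread = trans (cong (λ t → t + 0 + 0 + W) (triangular-+ I m)) (regroup e m f (triangular e) (triangular m))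
    where
    regroup : ∀ e m f te tm → e + te + tm + suc e * m + 0 + 0 + (m * suc (suc e + m + suc f) + suc e * suc f)
                            ≡ e + te + tm + m * suc (suc e + m + suc f) + (suc e * (m + suc f) + m * 0)
    regroup = solve-∀
  x+greatest : x + greatest I m (m + suc f) 0 ≡ suc h * (suc f + m) + triangular (suc h)
  x+greatest = trans (regroup e m f (triangular e) (triangular m))
                     (cong (λ t → suc h * (suc f + m) + (h + t)) (sym (triangular-+ I m)))
    where
    regroup : ∀ e m f te tm → suc e + m + suc f + (e + te + tm + m * suc (suc e + m + suc f) + (suc e * (m + suc f) + m * 0))
                            ≡ suc (suc e + m) * (suc f + m) + (suc e + m + (e + te + tm + suc e * m))
    regroup = solve-∀
  bounded : ∀ {s} → IsSum s → least h 0 ≤ s × s ≤ greatest I m (m + suc f) 0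
  bounded {s} s∈ = subst (_≤ s) (sym (trans (+-identityʳ _) (+-identityʳ _))) (sum-≥ s∈)
                 , +-cancelˡ-≤ x _ _ (subst (x + s ≤_) (sym x+greatest) (x+sum-≤ (suc f + m) (k+1≡h+1+p e m f) s∈))
    where
    k+1≡h+1+p : ∀ e m f → suc (suc e + m + suc f + m) ≡ suc (suc e + m) + (suc f + m)
    k+1≡h+1+p = solve-∀
  count : ∀ e m f → suc (m * suc (suc e + m + suc f) + suc e * suc f) + (suc e + m) * (suc e + m) + (suc e + m + suc f)
                  ≡ (suc e + m + 1) * (suc e + m + suc f + m) + 1
  count = solve-∀

card-hole≡h : ∀ {h x m} → 1 ≤ h → x ≡ h → h < m →
              restrictedSumsetCard h (punctured 0 x m) + h * h ≡ h * (x + m) + h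
card-hole≡h {suc g} (s≤s z≤n) refl h<m with <⇒≡+suc h<m
... | f , refl = trans (cong (λ c → c + h * h) (card-punctured {n = 0} least-block others bounded)) (count g f)
  where
  h m P : ℕ
  h = suc g
  m = h + suc f
  P = g + h * h + h * suc f
  open Blocks h m h
  least-block : Covers IsSum (triangular h) (triangular h + 0)
  least-block = subst₂ (Covers IsSum) (trans (+-identityʳ _) (+-identityʳ _)) (regroup (triangular h) h m)
                  (block-covers h 0 0 m (sym (+-identityʳ h)) refl (+-identityʳ h))
    where
    regroup : ∀ t h m → t + 0 + 0 + (h * 0 + 0 * m) ≡ t + 0
    regroup = solve-∀
  others : Covers IsSum (suc (triangular h + 1)) (triangular h + 1 + P)
  others = subst₂ (Covers IsSum) (first g (triangular g)) (last g f (triangular g))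
             (block-chain g 0 1 1 (suc f) (sym (+-comm g 1)) refl (+-comm g 1) (inj₂ (≤-refl , s≤s z≤n)))
    where
    first : ∀ g t → t + 0 + 1 * suc (suc g) ≡ suc (g + t + 1)
    first = solve-∀
    last : ∀ g f t → 0 + (g + t) + suc g * suc (suc g) + (0 * (g + 1) + suc g * suc f)
                   ≡ g + t + 1 + (g + suc g * suc g + suc g * suc f)
    last = solve-∀
  bounded : ∀ {s} → IsSum s → triangular h ≤ s × s ≤ triangular h + 1 + P × s ≢ triangular h + 1
  bounded {s} s∈ = sum-≥ s∈
                 , subst (s ≤_) (bound≡greatest g f (triangular h)) (sum-≤ (suc m) (sym (+-suc h m)) s∈)
                 , sum≢least+1 refl s∈
    where
    bound≡greatest : ∀ g f t → suc g * suc (suc g + suc f) + t ≡ t + 1 + (g + suc g * suc g + suc g * suc f)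
    bound≡greatest = solve-∀
  count : ∀ g f → suc (g + suc g * suc g + suc g * suc f) + suc g * suc g ≡ suc g * (suc g + (suc g + suc f)) + suc g
  count = solve-∀

card-hole≡k∸h : ∀ {h x m} → 1 ≤ h → m ≡ h → h < x →
                restrictedSumsetCard h (punctured 0 x m) + h * h ≡ h * (x + m) + h
card-hole≡k∸h {suc g} (s≤s z≤n) refl h<x with <⇒≡+suc h<x
... | f , refl = trans (cong (λ c → c + h * h) (card-punctured {n = n} {p = 1} others greatest-block bounded)) (count g f)
  where
  h x n : ℕ
  h = suc g
  x = h + suc f
  n = g * suc x + g + suc f
  open Blocks x h h
  others : Covers IsSum (triangular h) (triangular h + n)
  others = subst₂ (Covers IsSum) (trans (+-identityʳ _) (+-identityʳ _)) (regroup g f (triangular g))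
             (block-chain g 1 0 (suc f) 1 refl (sym (+-comm g 1)) (cong suc (+-identityʳ g)) (inj₁ (≤-refl , s≤s z≤n)))
    where
    regroup : ∀ g f t → 0 + t + g * suc (suc g + suc f) + (1 * (g + suc f) + g * 1)
                      ≡ g + t + (g * suc (suc g + suc f) + g + suc f)
    regroup = solve-∀
  greatest≡ : triangular h + suc n + 1 ≡ h * suc x + triangular h
  greatest≡ = regroup g f (triangular g)
    where
    regroup : ∀ g f t → g + t + suc (g * suc (suc g + suc f) + g + suc f) + 1 ≡ suc g * suc (suc g + suc f) + (g + t)
    regroup = solve-∀
  greatest-block : Covers IsSum (suc (triangular h + suc n)) (triangular h + suc n + 1)
  greatest-block =
    subst₂ (Covers IsSum) (regroup g f (triangular g)) (trans (regroup′ (h * suc x) (triangular h) h x) (sym greatest≡))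
      (block-covers 0 h x 0 refl (sym (+-identityʳ h)) refl)
    where
    regroup : ∀ g f t → 0 + (g + t) + suc g * suc (suc g + suc f) ≡ suc (g + t + suc (g * suc (suc g + suc f) + g + suc f))
    regroup = solve-∀
    regroup′ : ∀ a t h x → 0 + t + a + (0 * x + h * 0) ≡ a + t
    regroup′ = solve-∀
  bounded : ∀ {s} → IsSum s → triangular h ≤ s × s ≤ triangular h + suc n + 1 × s ≢ triangular h + suc n
  bounded {s} s∈ = sum-≥ s∈
                 , subst (s ≤_) (sym greatest≡) (sum-≤ (suc x) (trans (cong suc (+-comm x h)) (sym (+-suc h x))) s∈)
                 , λ s≡ → suc-sum≢greatest refl s∈ (trans (cong suc s≡) (trans (+-comm 1 _) greatest≡))
  count : ∀ g f → suc (g * suc (suc g + suc f) + g + suc f) + 1 + suc g * suc g ≡ suc g * (suc g + suc f + suc g) + suc g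
  count = solve-∀

ℤ-transpose : ∀ (c q p r : ℤ) → c +ℤ q ≡ p +ℤ r → c ≡ p -ℤ q +ℤ r
ℤ-transpose c q p r eq = begin
  c              ≡⟨ add-sub c q ⟩
  c +ℤ q -ℤ q    ≡⟨ cong (_-ℤ q) eq ⟩
  p +ℤ r -ℤ q    ≡⟨ sub-swap p r q ⟩
  p -ℤ q +ℤ r    ∎
  where
  open ≡-Reasoning
  add-sub : ∀ c q → c ≡ c +ℤ q -ℤ q
  add-sub = ℤ-Solver.solve-∀
  sub-swap : ∀ p r q → p +ℤ r -ℤ q ≡ p -ℤ q +ℤ r
  sub-swap = ℤ-Solver.solve-∀

card-to-ℤ : ∀ h k r {c} → c + h * h ≡ h * k + r → + c ≡ (+ h *ℤ + k) -ℤ (+ h *ℤ + h) +ℤ + r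
card-to-ℤ h k r {c} eq = ℤ-transpose (+ c) (+ h *ℤ + h) (+ h *ℤ + k) (+ r)
  (subst₂ (λ q p → + c +ℤ q ≡ p +ℤ + r) (ℤ.pos-* h h) (ℤ.pos-* h k) (cong +_ eq))

card-to-ℤ′ : ∀ h k x {c} → c + h * h + x ≡ (h + 1) * k + 1 →
             + c ≡ (+ (h + 1) *ℤ + k) -ℤ (+ h *ℤ + h) -ℤ + x +ℤ + 1
card-to-ℤ′ h k x {c} eq = trans
  (ℤ-transpose (+ c) (+ h *ℤ + h +ℤ + x) (+ (h + 1) *ℤ + k) (+ 1)
    (trans (sym (ℤ.+-assoc (+ c) (+ h *ℤ + h) (+ x)))
           (subst₂ (λ q p → + c +ℤ q +ℤ + x ≡ p +ℤ + 1) (ℤ.pos-* h h) (ℤ.pos-* (h + 1) k) (cong +_ eq))))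
  (sub-sub (+ (h + 1) *ℤ + k) (+ h *ℤ + h) (+ x) (+ 1))
  where
  sub-sub : ∀ p q x r → p -ℤ (q +ℤ x) +ℤ r ≡ p -ℤ q -ℤ x +ℤ r
  sub-sub = ℤ-Solver.solve-∀

x≤h⇒h<m : ∀ {h x m} → x ≤ h → 3 * h + 1 ≤ x + m → h < m
x≤h⇒h<m {h} {x} {m} x≤h 3h+1≤k = +-cancelˡ-≤ x (suc h) m (begin
  x + suc h      ≤⟨ +-monoˡ-≤ (suc h) x≤h ⟩
  h + suc h      ≤⟨ m≤m+n (h + suc h) h ⟩
  h + suc h + h  ≡⟨ three h ⟩
  3 * h + 1      ≤⟨ 3h+1≤k ⟩
  x + m          ∎)
  where
  open ≤-Reasoning
  three : ∀ h → h + suc h + h ≡ 3 * h + 1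
  three = solve-∀

k∸h+1≤x⇒m<h : ∀ {h x m} → h ≤ x + m → x + m ∸ h + 1 ≤ x → m < h
k∸h+1≤x⇒m<h {h} {x} {m} h≤k k∸h+1≤x = +-cancelˡ-≤ x (suc m) h (begin
  x + suc m            ≡⟨ +-suc x m ⟩
  suc (x + m)          ≡⟨ cong suc (sym (m∸n+n≡m h≤k)) ⟩
  suc (x + m ∸ h) + h  ≡⟨ cong (_+ h) (+-comm 1 (x + m ∸ h)) ⟩
  x + m ∸ h + 1 + h    ≤⟨ +-monoˡ-≤ h k∸h+1≤x ⟩
  x + h                ∎)
  where open ≤-Reasoning

x≤k∸h∸1⇒h<m : ∀ {h x m} → 1 + h ≤ x + m → x ≤ x + m ∸ h ∸ 1 → h < m
x≤k∸h∸1⇒h<m {h} {x} {m} 1+h≤k x≤k∸h∸1 = +-cancelˡ-≤ x (suc h) m (subst (_≤ x + m) (+-assoc x 1 h)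
  (m≤o∸n⇒m+n≤o (x + 1) (≤-trans (n≤1+n h) 1+h≤k) (m≤o∸n⇒m+n≤o x (m+n≤o⇒m≤o∸n 1 1+h≤k) x≤k∸h∸1)))

x≡k∸h⇒m≡h : ∀ {h x m} → h ≤ x + m → x ≡ x + m ∸ h → m ≡ h
x≡k∸h⇒m≡h {h} {x} {m} h≤k x≡k∸h = +-cancelˡ-≡ x m h (trans (sym (m∸n+n≡m h≤k)) (cong (_+ h) (sym x≡k∸h)))

proposition2p1 : (h k x : ℕ) → 3 ≤ h → 3 * h + 1 ≤ k → 1 ≤ x → x ≤ k ∸ 1 →
    ((1 ≤ x × x ≤ h ∸ 1) →
      + restrictedSumsetCard h (intervalMinus k x) ≡ (+ h *ℤ + k) -ℤ (+ h *ℤ + h) +ℤ + x +ℤ + 1)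
    × ((k ∸ h + 1 ≤ x × x ≤ k ∸ 1) →
      + restrictedSumsetCard h (intervalMinus k x) ≡ (+ (h + 1) *ℤ + k) -ℤ (+ h *ℤ + h) -ℤ + x +ℤ + 1)
    × ((x ≡ h ⊎ x ≡ k ∸ h) →
      + restrictedSumsetCard h (intervalMinus k x) ≡ (+ h *ℤ + k) -ℤ (+ h *ℤ + h) +ℤ + h)
    × ((h + 1 ≤ x × x ≤ k ∸ h ∸ 1) →
      + restrictedSumsetCard h (intervalMinus k x) ≡ (+ h *ℤ + k) -ℤ (+ h *ℤ + h) +ℤ + h +ℤ + 1)
proposition2p1 h@(suc h′) k x 3≤h 3h+1≤k _ x≤k∸1 with m≤n⇒∃[o]m+o≡n (≤-trans x≤k∸1 (m∸n≤m k 1))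
... | m , refl rewrite intervalMinus≡punctured x m =
    (λ (_ , x≤h′) →
       trans (card-to-ℤ h k (x + 1) (card-hole<h (s≤s x≤h′) (x≤h⇒h<m (≤-trans x≤h′ (n≤1+n h′)) 3h+1≤k)))
             (sym (ℤ.+-assoc Δ (+ x) (+ 1))))
  , (λ (k∸h+1≤x , _) → let m<h = k∸h+1≤x⇒m<h h≤k k∸h+1≤x in
       card-to-ℤ′ h k x (card-hole>k∸h m<h (x≤h⇒h<m (<⇒≤ m<h) 3h+1≤m+x)))
  , [ (λ x≡h → card-to-ℤ h k h (card-hole≡h 1≤h x≡h (x≤h⇒h<m (≤-reflexive x≡h) 3h+1≤k)))
    , (λ x≡k∸h → let m≡h = x≡k∸h⇒m≡h h≤k x≡k∸h in
         card-to-ℤ h k h (card-hole≡k∸h 1≤h m≡h (x≤h⇒h<m (≤-reflexive m≡h) 3h+1≤m+x))) ]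
  , (λ (h+1≤x , x≤k∸h∸1) →
       trans (card-to-ℤ h k (h + 1)
               (card-hole-middle 2≤h (subst (_≤ x) (+-comm h 1) h+1≤x) (x≤k∸h∸1⇒h<m 1+h≤k x≤k∸h∸1)))
             (sym (ℤ.+-assoc Δ (+ h) (+ 1))))
  where
  Δ : ℤ
  Δ = (+ h *ℤ + k) -ℤ (+ h *ℤ + h)
  1≤h : 1 ≤ h
  1≤h = ≤-trans (s≤s z≤n) 3≤h
  2≤h : 2 ≤ h
  2≤h = ≤-trans (s≤s (s≤s z≤n)) 3≤h
  3h+1≤m+x : 3 * h + 1 ≤ m + x
  3h+1≤m+x = subst (3 * h + 1 ≤_) (+-comm x m) 3h+1≤k
  1+h≤k : 1 + h ≤ k
  1+h≤k = ≤-trans (subst (suc h ≤_) (+-comm 1 (3 * h)) (s≤s (m≤n*m h 3))) 3h+1≤k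
  h≤k : h ≤ k
  h≤k = ≤-trans (n≤1+n h) 1+h≤k
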